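{- Let $n\ge 1$ and let $a=(a_1,a_2,\dots,a_n)$ and $b=(b_1,b_2,\dots,b_n)$ be two $n$-digit natural numbers written in decimal, where for integers $x_1,\dots,x_m$ the notation $(x_1,\dots,x_m)$ denotes $\sum_{i=1}^m x_i 10^{m-i}$ (entries are allowed to be arbitrary integers, including negative ones or ones exceeding $9$). Let $C_i=a_ib_i$ for $i=1,\dots,n$ (the vertical product $C=(C_1,\dots,C_n)$). For $k=1,\dots,2n-1$ let $$K_k=\sum_{\substack{1\le i<j\le n\\ i+j=k+1}}(a_i-a_j)(b_i-b_j),$$ so that $K_1=K_{2n-1}=0$, $K_k=K_{12\cdots k}$ for $2\le k\le n$ and $K_k=K_{(k-n+1)\cdots n}$ for $n\le k\le 2n-2$ (symmetric differences of consecutive index ranges), and let the tare be $K=(K_1,K_2,\dots,K_{2n-1})=(0,K_{12},K_{123},\dots,K_{12\cdots n},K_{2\cdots n},\dots,K_{n-1,n},0)$. Then $$(a_1,a_2,\dots,a_n)\times(b_1,b_2,\dots,b_n)=(C_1,C_2,\dots,C_n)\times(\underbrace{1,1,\dots,1}_{n})-K,$$ that is, $a\times b=\Big(\sum_{i=1}^n C_i10^{n-i}\Big)\Big(\sum_{j=0}^{n-1}10^j\Big)-\sum_{k=1}^{2n-1}K_k10^{2n-1-k}$.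
   Context: For a consecutive index range $p,p+1,\dots,q$, the symmetric difference is $K_{p\cdots q}=\sum_{p\le i<j\le q,\ i+j=p+q}(a_i-a_j)(b_i-b_j)$, i.e. the sum of the difference products $K_{ij}=(a_i-a_j)(b_i-b_j)$ over the symmetric pairs of the range (the middle index, if any, is omitted). -}

module Defs where

open import Data.Nat using (ℕ; zero; suc; _∸_; _≡ᵇ_)
open import Data.Fin using (Fin; toℕ)
open import Data.Integer using (ℤ; +_; _+_; _-_; _*_; _^_)
open import Data.Bool using (if_then_else_)

sumℤ : (m : ℕ) → (ℕ → ℤ) → ℤ
sumℤ zero    f = + 0
sumℤ (suc m) f = sumℤ m f + f m

sumFin : (m : ℕ) → (Fin m → ℤ) → ℤ
sumFin zero    f = + 0
sumFin (suc m) f = f Data.Fin.zero + sumFin m (λ i → f (Data.Fin.suc i))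

-- Decimal value (x_1,...,x_m) = Σ_{i=1}^m x_i 10^(m-i); here x is 0-indexed:
-- position i : Fin m corresponds to the paper's index i+1.
dec : (m : ℕ) → (Fin m → ℤ) → ℤ
dec m x = sumFin m (λ i → x i * (+ 10) ^ (m ∸ suc (toℕ i)))

ones : (n : ℕ) → Fin n → ℤ
ones n _ = + 1

vert : (n : ℕ) → (Fin n → ℤ) → (Fin n → ℤ) → Fin n → ℤ
vert n a b i = a i * b i

Kij : {n : ℕ} → (Fin n → ℤ) → (Fin n → ℤ) → Fin n → Fin n → ℤ
Kij a b i j = (a i - a j) * (b i - b j)

_<ᵇ'_ : ℕ → ℕ → Data.Bool.Bool
m <ᵇ' n = Data.Nat._<ᵇ_ m n

-- Tare entry with 0-based position t ∈ {0,…,2n-2} (paper's k = t+1):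
-- K_k = Σ_{1≤i<j≤n, i+j=k+1} K_ij; in 0-based indices i<j, i+j = t.
tareEntry : (n : ℕ) → (Fin n → ℤ) → (Fin n → ℤ) → ℕ → ℤ
tareEntry n a b t =
  sumFin n (λ i → sumFin n (λ j →
    if (toℕ i <ᵇ' toℕ j) Data.Bool.∧ ((toℕ i Data.Nat.+ toℕ j) ≡ᵇ t)
    then Kij a b i j else + 0))

-- Tare K = (K_1,…,K_{2n-1}) as a (2n-1)-digit number:
-- Σ_{k=1}^{2n-1} K_k 10^{2n-1-k} = Σ_{t=0}^{2n-2} K_{t+1} 10^{2n-2-t}
tare : (n : ℕ) → (Fin n → ℤ) → (Fin n → ℤ) → ℤ
tare n a b =
  sumℤ (2 Data.Nat.* n ∸ 1)
    (λ t → tareEntry n a b t * (+ 10) ^ ((2 Data.Nat.* n ∸ 1) ∸ suc t))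

-- Expand both products as double sums over digit pairs (i, j) with place value
-- 10^(2n-2-i-j). Then a × b is the sum of a_i b_j and C × (1,…,1) the sum of
-- a_i b_i. The two double sums have the same diagonal, and on each symmetric
-- pair {(i, j), (j, i)} with i < j they differ by
--   a_i b_i + a_j b_j - a_i b_j - a_j b_i = (a_i - a_j)(b_i - b_j) = K_ij,
-- which is exactly what the tare collects at position i + j.
module Submission where

open import Defs
open import Data.Bool using (Bool; true; false; if_then_else_; _∧_)
open import Data.Bool.Properties using (T-≡; ¬-not; ∧-zeroʳ; ∧-identityʳ)
open import Data.Nat as ℕ using (ℕ; zero; suc; _∸_; _<_; _≤_; _≥_; z≤n; s≤s; _<ᵇ_; _≡ᵇ_)
import Data.Nat.Properties as ℕ
open import Data.Fin using (Fin; toℕ; inject₁; fromℕ)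
open import Data.Fin.Patterns using (0F)
open import Data.Fin.Properties using (toℕ<n; toℕ-inject₁; toℕ-fromℕ; toℕ-injective)
open import Data.Vec.Functional using (tail)
open import Data.Integer using (ℤ; +_; _+_; _-_; _*_; _^_)
import Data.Integer.Properties as ℤ
open import Data.Integer.Tactic.RingSolver using (solve-∀)
open import Algebra.Properties.Semiring.Sum ℤ.+-*-semiring
  using (sum; sum-syntax; sum-cong-≗; sum-replicate-zero; sum-init-last;
         ∑-distrib-+; ∑-comm; *-distribˡ-sum; *-distribʳ-sum)
open import Algebra.Properties.CommutativeSemigroup ℤ.*-commutativeSemigroup
  using () renaming (interchange to *-interchange)
open import Function using (_∘_; Equivalence)
open import Relation.Binary.PropositionalEquality
  using (_≡_; _≢_; refl; sym; trans; cong; cong₂; module ≡-Reasoning)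
open import Relation.Nullary using (contradiction)
open import Relation.Nullary.Reflects using (ofʸ; ofⁿ)

open ≡-Reasoning

sumFin≡sum : ∀ m (f : Fin m → ℤ) → sumFin m f ≡ sum f
sumFin≡sum zero    f = refl
sumFin≡sum (suc m) f = cong (_+_ (f 0F)) (sumFin≡sum m (tail f))

sumℤ≡sum : ∀ m (f : ℕ → ℤ) → sumℤ m f ≡ ∑[ t < m ] f (toℕ t)
sumℤ≡sum zero    f = refl
sumℤ≡sum (suc m) f = begin
  sumℤ m f + f m
    ≡⟨ cong (_+ f m) (sumℤ≡sum m f) ⟩
  ∑[ t < m ] f (toℕ t) + f m
    ≡⟨ cong₂ _+_ (sum-cong-≗ {m} (cong f ∘ toℕ-inject₁)) (cong f (toℕ-fromℕ m)) ⟨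
  ∑[ t < m ] f (toℕ (inject₁ t)) + f (toℕ (fromℕ m))
    ≡⟨ sum-init-last {m} (f ∘ toℕ) ⟨
  ∑[ t < suc m ] f (toℕ t)
    ∎

sum-*-sum : ∀ {m n} (f : Fin m → ℤ) (g : Fin n → ℤ) →
            sum f * sum g ≡ ∑[ i < m ] ∑[ j < n ] (f i * g j)
sum-*-sum f g = trans (*-distribʳ-sum (sum g) f) (sum-cong-≗ (λ i → *-distribˡ-sum (f i) g))

∑∑-*ʳ : ∀ {m n} (f : Fin m → Fin n → ℤ) c →
        (∑[ i < m ] ∑[ j < n ] f i j) * c ≡ ∑[ i < m ] ∑[ j < n ] (f i j * c)
∑∑-*ʳ {n = n} f c =
  trans (*-distribʳ-sum c (λ i → ∑[ j < n ] f i j)) (sum-cong-≗ (λ i → *-distribʳ-sum c (f i)))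

∑∑-distrib-+ : ∀ {m n} (f g : Fin m → Fin n → ℤ) →
               ∑[ i < m ] ∑[ j < n ] (f i j + g i j) ≡
               ∑[ i < m ] ∑[ j < n ] f i j + ∑[ i < m ] ∑[ j < n ] g i j
∑∑-distrib-+ f g =
  trans (sum-cong-≗ (λ i → ∑-distrib-+ (f i) (g i))) (∑-distrib-+ (λ i → sum (f i)) (λ i → sum (g i)))

x+x≡y+y⇒x≡y : ∀ {x y : ℤ} → x + x ≡ y + y → x ≡ y
x+x≡y+y⇒x≡y {x} {y} eq = ℤ.*-cancelˡ-≡ (+ 2) x y (trans (sym (double x)) (trans eq (double y)))
  where
  double : ∀ z → z + z ≡ + 2 * z
  double = solve-∀

∑∑-cong-symmetrised : ∀ {n} (f g : Fin n → Fin n → ℤ) →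
                      (∀ i j → f i j + f j i ≡ g i j + g j i) →
                      ∑[ i < n ] ∑[ j < n ] f i j ≡ ∑[ i < n ] ∑[ j < n ] g i j
∑∑-cong-symmetrised {n} f g eq = x+x≡y+y⇒x≡y (begin
  ∑∑ f + ∑∑ f                      ≡⟨ cong (_+_ (∑∑ f)) (∑-comm f) ⟩
  ∑∑ f + ∑∑ (λ i j → f j i)        ≡⟨ ∑∑-distrib-+ f _ ⟨
  ∑∑ (λ i j → f i j + f j i)       ≡⟨ sum-cong-≗ (λ i → sum-cong-≗ (eq i)) ⟩
  ∑∑ (λ i j → g i j + g j i)       ≡⟨ ∑∑-distrib-+ g _ ⟩
  ∑∑ g + ∑∑ (λ i j → g j i)        ≡⟨ cong (_+_ (∑∑ g)) (∑-comm g) ⟨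
  ∑∑ g + ∑∑ g                      ∎)
  where
  ∑∑ : (Fin n → Fin n → ℤ) → ℤ
  ∑∑ h = ∑[ i < n ] ∑[ j < n ] h i j

∑-single : ∀ m (g : ℕ → ℤ) s → s < m → (∀ t → t ≢ s → g t ≡ + 0) →
           ∑[ t < m ] g (toℕ t) ≡ g s
∑-single (suc m) g zero _ vanish = begin
  g 0 + ∑[ t < m ] g (suc (toℕ t))
    ≡⟨ cong (_+_ (g 0)) (sum-cong-≗ {m} (λ t → vanish (suc (toℕ t)) (λ ()))) ⟩
  g 0 + sum {m} (λ _ → + 0)
    ≡⟨ cong (_+_ (g 0)) (sum-replicate-zero m) ⟩
  g 0 + + 0
    ≡⟨ ℤ.+-identityʳ (g 0) ⟩
  g 0
    ∎
∑-single (suc m) g (suc s) (s≤s s<m) vanish = begin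
  g 0 + ∑[ t < m ] g (suc (toℕ t))
    ≡⟨ cong₂ _+_ (vanish 0 (λ ())) (∑-single m (g ∘ suc) s s<m vanish∘suc) ⟩
  + 0 + g (suc s)
    ≡⟨ ℤ.+-identityˡ (g (suc s)) ⟩
  g (suc s)
    ∎
  where
  vanish∘suc : ∀ t → t ≢ s → g (suc t) ≡ + 0
  vanish∘suc t t≢s = vanish (suc t) (t≢s ∘ ℕ.suc-injective)

≡ᵇ-refl : ∀ n → (n ≡ᵇ n) ≡ true
≡ᵇ-refl n = Equivalence.to T-≡ (ℕ.≡⇒≡ᵇ n n refl)

≢⇒≡ᵇ≡false : ∀ {m n} → m ≢ n → (m ≡ᵇ n) ≡ false
≢⇒≡ᵇ≡false {m} {n} m≢n = ¬-not (m≢n ∘ ℕ.≡ᵇ⇒≡ m n ∘ Equivalence.from T-≡)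

∑-select : ∀ m (b : Bool) (x : ℤ) (e : ℕ → ℤ) s → s < m →
           ∑[ t < m ] ((if b ∧ (s ≡ᵇ toℕ t) then x else + 0) * e (toℕ t)) ≡
           (if b then x else + 0) * e s
∑-select m b x e s s<m =
  trans (∑-single m selected s s<m vanish) (cong (λ c → (if c then x else + 0) * e s) select)
  where
  selected : ℕ → ℤ
  selected t = (if b ∧ (s ≡ᵇ t) then x else + 0) * e t

  vanish : ∀ t → t ≢ s → selected t ≡ + 0
  vanish t t≢s rewrite ≢⇒≡ᵇ≡false (t≢s ∘ sym) | ∧-zeroʳ b = ℤ.*-zeroˡ (e t)

  select : b ∧ (s ≡ᵇ s) ≡ b
  select = trans (cong (b ∧_) (≡ᵇ-refl s)) (∧-identityʳ b)

place : ℕ → ℕ → ℤ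
place m s = (+ 10) ^ (m ∸ suc s)

[m∸n]+[o∸p]≡[m+o]∸[n+p] : ∀ {m n o p} → n ≤ m → p ≤ o → (m ∸ n) ℕ.+ (o ∸ p) ≡ (m ℕ.+ o) ∸ (n ℕ.+ p)
[m∸n]+[o∸p]≡[m+o]∸[n+p] {m} {zero}  z≤n       p≤o = sym (ℕ.+-∸-assoc m p≤o)
[m∸n]+[o∸p]≡[m+o]∸[n+p] {suc m} {suc n} (s≤s n≤m) p≤o = [m∸n]+[o∸p]≡[m+o]∸[n+p] n≤m p≤o

2*[1+k]∸1≡[1+k]+k : ∀ k → 2 ℕ.* suc k ∸ 1 ≡ suc k ℕ.+ k
2*[1+k]∸1≡[1+k]+k k = trans (ℕ.+-suc k (k ℕ.+ 0)) (cong (λ z → suc (k ℕ.+ z)) (ℕ.+-identityʳ k))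

+-<-2*∸1 : ∀ {n i j} → i < n → j < n → i ℕ.+ j < 2 ℕ.* n ∸ 1
+-<-2*∸1 {suc k} (s≤s i≤k) (s≤s j≤k) rewrite 2*[1+k]∸1≡[1+k]+k k = s≤s (ℕ.+-mono-≤ i≤k j≤k)

place-* : ∀ {n i j} → i < n → j < n → place n i * place n j ≡ place (2 ℕ.* n ∸ 1) (i ℕ.+ j)
place-* {suc k} {i} {j} (s≤s i≤k) (s≤s j≤k) = begin
  (+ 10) ^ (k ∸ i) * (+ 10) ^ (k ∸ j)
    ≡⟨ ℤ.^-distribˡ-+-* (+ 10) (k ∸ i) (k ∸ j) ⟨
  (+ 10) ^ ((k ∸ i) ℕ.+ (k ∸ j))
    ≡⟨ cong (_^_ (+ 10)) ([m∸n]+[o∸p]≡[m+o]∸[n+p] i≤k j≤k) ⟩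
  (+ 10) ^ ((k ℕ.+ k) ∸ (i ℕ.+ j))
    ≡⟨ cong (λ m → (+ 10) ^ (m ∸ suc (i ℕ.+ j))) (2*[1+k]∸1≡[1+k]+k k) ⟨
  place (2 ℕ.* suc k ∸ 1) (i ℕ.+ j)
    ∎

pairPlace : ∀ n → Fin n → Fin n → ℤ
pairPlace n i j = place (2 ℕ.* n ∸ 1) (toℕ i ℕ.+ toℕ j)

dec-* : ∀ n (x y : Fin n → ℤ) →
        dec n x * dec n y ≡ ∑[ i < n ] ∑[ j < n ] (x i * y j * pairPlace n i j)
dec-* n x y = begin
  dec n x * dec n y
    ≡⟨ cong₂ _*_ (sumFin≡sum n _) (sumFin≡sum n _) ⟩
  ∑[ i < n ] (x i * place n (toℕ i)) * ∑[ j < n ] (y j * place n (toℕ j))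
    ≡⟨ sum-*-sum (λ i → x i * place n (toℕ i)) (λ j → y j * place n (toℕ j)) ⟩
  ∑[ i < n ] ∑[ j < n ] ((x i * place n (toℕ i)) * (y j * place n (toℕ j)))
    ≡⟨ sum-cong-≗ (λ i → sum-cong-≗ (λ j →
         trans (*-interchange (x i) _ (y j) _) (cong (x i * y j *_) (place-* (toℕ<n i) (toℕ<n j))))) ⟩
  ∑[ i < n ] ∑[ j < n ] (x i * y j * pairPlace n i j)
    ∎

dec-*-ones : ∀ n (x : Fin n → ℤ) →
             dec n x * dec n (ones n) ≡ ∑[ i < n ] ∑[ j < n ] (x i * pairPlace n i j)
dec-*-ones n x = trans (dec-* n x (ones n))
  (sum-cong-≗ (λ i → sum-cong-≗ (λ j → cong (_* pairPlace n i j) (ℤ.*-identityʳ (x i)))))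

upperK : ∀ {n} → (Fin n → ℤ) → (Fin n → ℤ) → Fin n → Fin n → ℤ
upperK a b i j = if toℕ i <ᵇ toℕ j then Kij a b i j else + 0

tare≡∑∑ : ∀ n (a b : Fin n → ℤ) →
          tare n a b ≡ ∑[ i < n ] ∑[ j < n ] (upperK a b i j * pairPlace n i j)
tare≡∑∑ n a b = begin
  tare n a b
    ≡⟨ sumℤ≡sum M _ ⟩
  ∑[ t < M ] (tareEntry n a b (toℕ t) * place M (toℕ t))
    ≡⟨ sum-cong-≗ {M} {y = λ t → ∑[ i < n ] ∑[ j < n ] term t i j}
                  (λ t → trans (cong (_* place M (toℕ t)) (tareEntry≡∑∑ (toℕ t)))
                               (∑∑-*ʳ (entry (toℕ t)) (place M (toℕ t)))) ⟩
  ∑[ t < M ] ∑[ i < n ] ∑[ j < n ] term t i j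
    ≡⟨ ∑-comm (λ t i → ∑[ j < n ] term t i j) ⟩
  ∑[ i < n ] ∑[ t < M ] ∑[ j < n ] term t i j
    ≡⟨ sum-cong-≗ (λ i → ∑-comm (λ t j → term t i j)) ⟩
  ∑[ i < n ] ∑[ j < n ] ∑[ t < M ] term t i j
    ≡⟨ sum-cong-≗ (λ i → sum-cong-≗ (λ j →
         ∑-select M (toℕ i <ᵇ toℕ j) (Kij a b i j) (place M) _ (+-<-2*∸1 (toℕ<n i) (toℕ<n j)))) ⟩
  ∑[ i < n ] ∑[ j < n ] (upperK a b i j * pairPlace n i j)
    ∎
  where
  M : ℕ
  M = 2 ℕ.* n ∸ 1

  entry : ℕ → Fin n → Fin n → ℤ
  entry t i j = if (toℕ i <ᵇ toℕ j) ∧ ((toℕ i ℕ.+ toℕ j) ≡ᵇ t) then Kij a b i j else + 0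

  term : Fin M → Fin n → Fin n → ℤ
  term t i j = entry (toℕ t) i j * place M (toℕ t)

  tareEntry≡∑∑ : ∀ t → tareEntry n a b t ≡ ∑[ i < n ] ∑[ j < n ] entry t i j
  tareEntry≡∑∑ t = trans (sumFin≡sum n (λ i → sumFin n (entry t i)))
                         (sum-cong-≗ (λ i → sumFin≡sum n (entry t i)))

upperK-+-transpose : ∀ {n} (a b : Fin n → ℤ) i j → upperK a b i j + upperK a b j i ≡ Kij a b i j
upperK-+-transpose a b i j
  with toℕ i <ᵇ toℕ j | ℕ.<ᵇ-reflects-< (toℕ i) (toℕ j)
     | toℕ j <ᵇ toℕ i | ℕ.<ᵇ-reflects-< (toℕ j) (toℕ i)
... | true  | ofʸ i<j | true  | ofʸ j<i = contradiction j<i (ℕ.<-asym i<j)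
... | true  | ofʸ _   | false | ofⁿ _   = ℤ.+-identityʳ (Kij a b i j)
... | false | ofⁿ _   | true  | ofʸ _   = trans (ℤ.+-identityˡ _) (Kij-sym (a i) (a j) (b i) (b j))
  where
  Kij-sym : ∀ ai aj bi bj → (aj - ai) * (bj - bi) ≡ (ai - aj) * (bi - bj)
  Kij-sym = solve-∀
... | false | ofⁿ i≮j | false | ofⁿ j≮i with toℕ-injective (ℕ.≤-antisym (ℕ.≮⇒≥ j≮i) (ℕ.≮⇒≥ i≮j))
...   | refl = sym (cong (_* (b i - b i)) (ℤ.+-inverseʳ (a i)))

cross-products : ∀ ai aj bi bj → ai * bi + aj * bj ≡ ai * bj + aj * bi + (ai - aj) * (bi - bj)
cross-products = solve-∀

symmetric-split : ∀ {n} (a b : Fin n → ℤ) p i j →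
                  a i * b i * p + a j * b j * p ≡
                  (a i * b j * p + upperK a b i j * p) + (a j * b i * p + upperK a b j i * p)
symmetric-split a b p i j = begin
  a i * b i * p + a j * b j * p
    ≡⟨ ℤ.*-distribʳ-+ p (a i * b i) (a j * b j) ⟨
  (a i * b i + a j * b j) * p
    ≡⟨ cong (_* p) (cross-products (a i) (a j) (b i) (b j)) ⟩
  (a i * b j + a j * b i + Kij a b i j) * p
    ≡⟨ cong (λ k → (a i * b j + a j * b i + k) * p) (upperK-+-transpose a b i j) ⟨
  (a i * b j + a j * b i + (upperK a b i j + upperK a b j i)) * p
    ≡⟨ regroup (a i * b j) (a j * b i) (upperK a b i j) (upperK a b j i) p ⟩
  (a i * b j * p + upperK a b i j * p) + (a j * b i * p + upperK a b j i * p)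
    ∎
  where
  regroup : ∀ u v s t q → (u + v + (s + t)) * q ≡ (u * q + s * q) + (v * q + t * q)
  regroup = solve-∀

vertical≡crossed+upperK : ∀ n (a b : Fin n → ℤ) →
  ∑[ i < n ] ∑[ j < n ] (a i * b i * pairPlace n i j) ≡
  ∑[ i < n ] ∑[ j < n ] (a i * b j * pairPlace n i j) +
  ∑[ i < n ] ∑[ j < n ] (upperK a b i j * pairPlace n i j)
vertical≡crossed+upperK n a b =
  trans (∑∑-cong-symmetrised _ _ pairwise) (∑∑-distrib-+ crossed upper)
  where
  crossed upper : Fin n → Fin n → ℤ
  crossed i j = a i * b j * pairPlace n i j
  upper   i j = upperK a b i j * pairPlace n i j

  pairwise : ∀ i j → a i * b i * pairPlace n i j + a j * b j * pairPlace n j i ≡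
                     (crossed i j + upper i j) + (crossed j i + upper j i)
  pairwise i j rewrite ℕ.+-comm (toℕ j) (toℕ i) = symmetric-split a b (pairPlace n i j) i j

mainTheorem2 : (n : ℕ) → n ≥ 1 → (a b : Fin n → ℤ) →
    dec n a * dec n b ≡ dec n (vert n a b) * dec n (ones n) - tare n a b
mainTheorem2 n _ a b = begin
  dec n a * dec n b
    ≡⟨ dec-* n a b ⟩
  crossed
    ≡⟨ add-sub crossed (tare n a b) ⟩
  crossed + tare n a b - tare n a b
    ≡⟨ cong (λ t → crossed + t - tare n a b) (tare≡∑∑ n a b) ⟩
  crossed + ∑[ i < n ] ∑[ j < n ] (upperK a b i j * pairPlace n i j) - tare n a b
    ≡⟨ cong (_- tare n a b) (vertical≡crossed+upperK n a b) ⟨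
  ∑[ i < n ] ∑[ j < n ] (a i * b i * pairPlace n i j) - tare n a b
    ≡⟨ cong (_- tare n a b) (dec-*-ones n (vert n a b)) ⟨
  dec n (vert n a b) * dec n (ones n) - tare n a b
    ∎
  where
  crossed : ℤ
  crossed = ∑[ i < n ] ∑[ j < n ] (a i * b j * pairPlace n i j)

  add-sub : ∀ x y → x ≡ x + y - y
  add-sub = solve-∀
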